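{- Let $k\ge1$. For $m\ge j\ge 2$, \[ GL_k(k(m-1)+1,\overline{j})=(z^{j-1}+z^j)q^{k\binom{j}{2}+j+k(m-j)}{m-2\brack j-2}_k. \]
   Context: Overpartitions here are non-increasing sequences of positive integers in which the last occurrence of each distinct part value may be overlined; a part $t$ or $\overline t$ has size $t$, written $|\cdot|=t$; $|\lambda|$ is the sum of part sizes and $\ell_o(\lambda)$ the number of overlined parts. An $L_k$-overpartition is an overpartition $\pi=(\pi_1,\ldots,\pi_\ell)$ such that whenever $\pi_i$ is overlined, $\ell-i\equiv 0\pmod k$. For $m\ge1$, $\mathcal{BL}_k(m)$ is the set of $L_k$-overpartitions $\lambda=(\lambda_1,\ldots,\lambda_m)$ with exactly $m$ parts such that $\lambda_m=\overline1$ or $1$, and for $1\le i<m$, $|\lambda_i|\le|\lambda_{i+1}|+1$, with strict inequality if $\lambda_i$ is non-overlined. For $m,j\ge1$, $\mathcal{BL}_k(m,\overline j)$ is the set of overpartitions in $\mathcal{BL}_k(m)$ whose largest part is $\overline j$, and $GL_k(m,\overline j)=\sum_{\lambda\in\mathcal{BL}_k(m,\overline j)}z^{\ell_o(\lambda)}q^{|\lambda|}$. Also ${A\brack B}_k=\frac{(q^k;q^k)_A}{(q^k;q^k)_B(q^k;q^k)_{A-B}}$ for $A\ge B\ge0$ and $0$ otherwise. -}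

module Defs where

open import Data.Nat using (ℕ; zero; suc; _+_; _*_; _∸_; _≡ᵇ_; _≤ᵇ_; _<ᵇ_)
open import Data.Nat.Divisibility using (_∣?_)
open import Data.Bool using (Bool; true; false; _∧_; _∨_; not; if_then_else_)
open import Data.Product using (_×_; _,_; proj₁; proj₂)
open import Data.List using (List; []; _∷_; length; map; concatMap; filterᵇ; applyUpTo)
open import Relation.Nullary.Decidable using (⌊_⌋)
open import Data.Integer as ℤ using (ℤ; +_)

-- Overpartitions
-- A part is (t , b): size t, overlined iff b = true.
Part : Set
Part = ℕ × Bool

size : Part → ℕ
size = proj₁

ov : Part → Bool
ov = proj₂

_⇒ᵇ_ : Bool → Bool → Bool
a ⇒ᵇ b = not a ∨ b

weight : List Part → ℕ
weight [] = 0
weight (x ∷ xs) = size x + weight xs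

numOv : List Part → ℕ
numOv [] = 0
numOv (x ∷ xs) = (if ov x then 1 else 0) + numOv xs

-- overpartition: positive parts, non-increasing, and only the last
-- occurrence of a value may be overlined (given non-increasing order this
-- means: an overlined part is either the last part or strictly larger than
-- the next part).
isOverpartition : List Part → Bool
isOverpartition [] = true
isOverpartition (x ∷ []) = 1 ≤ᵇ size x
isOverpartition (x ∷ y ∷ ys) =
  (1 ≤ᵇ size x) ∧ (size y ≤ᵇ size x) ∧ (ov x ⇒ᵇ (size y <ᵇ size x))
  ∧ isOverpartition (y ∷ ys)

-- L_k condition: if π_i is overlined then k ∣ (ℓ - i); note ℓ - i is the
-- number of parts after π_i.
isLk : ℕ → List Part → Bool
isLk k [] = true
isLk k (x ∷ xs) = (ov x ⇒ᵇ ⌊ k ∣? length xs ⌋) ∧ isLk k xs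

blChain : List Part → Bool
blChain [] = false
blChain (x ∷ []) = size x ≡ᵇ 1
blChain (x ∷ y ∷ ys) =
  (size x ≤ᵇ size y + 1) ∧ (not (ov x) ⇒ᵇ (size x <ᵇ size y + 1))
  ∧ blChain (y ∷ ys)

firstIsOv : ℕ → List Part → Bool
firstIsOv j [] = false
firstIsOv j (x ∷ xs) = (size x ≡ᵇ j) ∧ ov x

inBL : ℕ → ℕ → ℕ → List Part → Bool
inBL k M j l = (length l ≡ᵇ M) ∧ isOverpartition l ∧ isLk k l ∧ blChain l
               ∧ firstIsOv j l

-- Every element of BL_k(M, j̄) is among them (parts are ≤ the largest part j),
-- so this list is a finite superset over which we count.
partsUpTo : ℕ → List Part
partsUpTo j = concatMap (λ t → (suc t , false) ∷ (suc t , true) ∷ []) (applyUpTo (λ i → i) j)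

candidates : ℕ → ℕ → List (List Part)
candidates zero j = [] ∷ []
candidates (suc M) j = concatMap (λ p → map (p ∷_) (candidates M j)) (partsUpTo j)

-- Polynomials in z, q with integer coefficients: coefficient of z^a q^n.
Poly : Set
Poly = ℕ → ℕ → ℤ

sumTo : ℕ → (ℕ → ℤ) → ℤ
sumTo zero f = f 0
sumTo (suc n) f = sumTo n f ℤ.+ f (suc n)

_⊕_ : Poly → Poly → Poly
(f ⊕ g) a n = f a n ℤ.+ g a n

_⊖_ : Poly → Poly → Poly
(f ⊖ g) a n = f a n ℤ.- g a n

_⊛_ : Poly → Poly → Poly
(f ⊛ g) a n = sumTo a (λ a' → sumTo n (λ n' → f a' n' ℤ.* g (a ∸ a') (n ∸ n')))

mono : ℕ → ℕ → Poly
mono a n a' n' = if (a ≡ᵇ a') ∧ (n ≡ᵇ n') then + 1 else + 0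

one : Poly
one = mono 0 0

poch : ℕ → ℕ → Poly
poch k zero = one
poch k (suc N) = poch k N ⊛ (one ⊖ mono 0 (k * suc N))

-- GL_k(M, j̄) = Σ_{λ ∈ BL_k(M, j̄)} z^{ℓ_o(λ)} q^{|λ|}, as coefficients:
-- coefficient of z^a q^n = #{λ ∈ BL_k(M, j̄) : ℓ_o(λ) = a, |λ| = n}.
GL : ℕ → ℕ → ℕ → Poly
GL k M j a n = + length (filterᵇ (λ l → inBL k M j l ∧ (numOv l ≡ᵇ a) ∧ (weight l ≡ᵇ n))
                                (candidates M j))

-- In an element of BL_k(M, j̄) the part sizes are constant except for a drop by one right after each
-- overlined part, and an overlined part is followed by a multiple of k parts. Removing the first
-- part j̄ leaves a chain whose generating function obeys a first-order recursion in the number of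
-- parts. Over a block of k parts only the last step can be overlined, and the recursion becomes the
-- q-Pascal rule for the q^k-binomial coefficient [m-2, j-2]; with the denominators (q^k;q^k) cleared,
-- the closed form follows by double induction on j - 2 and m - j.

{-# OPTIONS --safe #-}
module Submission where

open import Defs
open import Algebra.Bundles using (CommutativeRing)
import Algebra.Properties.CommutativeSemigroup as CommSemigroupProperties
import Algebra.Solver.Ring
open import Algebra.Solver.Ring.AlmostCommutativeRing
  using (AlmostCommutativeRing; fromCommutativeRing; _-Raw-AlmostCommutative⟶_; Induced-equivalence)
open import Data.Bool using (Bool; true; false; _∧_; not; if_then_else_)
open import Data.Bool.Properties using (∧-commutativeMonoid)
open import Algebra.Solver.CommutativeMonoid ∧-commutativeMonoid
  using (_⊜_) renaming (solve to ∧-solve; _⊕_ to _∧ₑ_)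
import Data.Integer as ℤ
open import Data.Integer using (ℤ; +_) renaming (_+_ to _+ℤ_; _*_ to _*ℤ_; -_ to -ℤ_)
import Data.Integer.Properties as ℤₚ
open import Data.List using (List; []; _∷_; _++_; map; concatMap; length; filterᵇ; applyUpTo)
import Data.List.Properties as Listₚ
open import Data.List.Relation.Unary.All as All using (All; []; _∷_)
open import Data.List.Relation.Unary.All.Properties using (concat⁺; map⁺; applyUpTo⁺₂)
open import Data.Maybe using (just; nothing)
open import Data.Nat using (ℕ; zero; suc; _+_; _*_; _∸_; _≤_; _<_; _≡ᵇ_; _≤ᵇ_; _<ᵇ_; s≤s; z≤n)
open import Data.Nat.Combinatorics using (_C_; nC1≡n; nCk+nC[k+1]≡[n+1]C[k+1])
open import Data.Nat.Divisibility using (_∣_; _∣?_; _∣0; ∣m+n∣m⇒∣n; m∣m*n; ∣⇒≤)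
open import Data.Nat.Properties as ℕₚ using (_≤?_; _≟_; <-cmp; ≤-pred; <⇒≱; ≤-refl; n<1+n)
open import Data.Nat.Tactic.RingSolver using (solve-∀)
open import Data.Product using (_×_; _,_)
open import Function using (_∘_)
open import Level using (0ℓ)
open import Relation.Binary.Definitions using (WeaklyDecidable; tri<; tri≈; tri>)
open import Relation.Binary.PropositionalEquality
  using (_≡_; _≢_; refl; sym; trans; cong; cong₂; subst; module ≡-Reasoning)
import Relation.Binary.Reasoning.Setoid
open import Relation.Binary.Structures using (IsEquivalence)
open import Relation.Nullary.Decidable using (Dec; yes; no; ⌊_⌋; isYes≗does; dec-true; dec-false)
open import Relation.Nullary.Negation using (¬_)

open CommSemigroupProperties ℤₚ.+-commutativeSemigroup using (interchange)

infix 4 _≐_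

_≐_ : Poly → Poly → Set
f ≐ g = ∀ a n → f a n ≡ g a n

zeroᴾ : Poly
zeroᴾ _ _ = + 0

≤ᵇ-true : ∀ {m n} → m ≤ n → (m ≤ᵇ n) ≡ true
≤ᵇ-true {m} {n} = dec-true (m ≤? n)

≤ᵇ-false : ∀ {m n} → n < m → (m ≤ᵇ n) ≡ false
≤ᵇ-false {m} {n} n<m = dec-false (m ≤? n) (<⇒≱ n<m)

≡ᵇ-true : ∀ {m n} → m ≡ n → (m ≡ᵇ n) ≡ true
≡ᵇ-true {m} {n} = dec-true (m ≟ n)

≡ᵇ-false : ∀ {m n} → m ≢ n → (m ≡ᵇ n) ≡ false
≡ᵇ-false {m} {n} = dec-false (m ≟ n)

⌊⌋-true : ∀ {A : Set} (A? : Dec A) → A → ⌊ A? ⌋ ≡ true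
⌊⌋-true A? a = trans (isYes≗does A?) (dec-true A? a)

⌊⌋-false : ∀ {A : Set} (A? : Dec A) → ¬ A → ⌊ A? ⌋ ≡ false
⌊⌋-false A? ¬a = trans (isYes≗does A?) (dec-false A? ¬a)

sumTo-cong : ∀ N {f g : ℕ → ℤ} → (∀ i → f i ≡ g i) → sumTo N f ≡ sumTo N g
sumTo-cong zero    f≗g = f≗g 0
sumTo-cong (suc N) f≗g = cong₂ _+ℤ_ (sumTo-cong N f≗g) (f≗g (suc N))

sumTo-+ : ∀ N (f g : ℕ → ℤ) → sumTo N (λ i → f i +ℤ g i) ≡ sumTo N f +ℤ sumTo N g
sumTo-+ zero    f g = refl
sumTo-+ (suc N) f g =
  trans (cong (_+ℤ (f (suc N) +ℤ g (suc N))) (sumTo-+ N f g))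
        (interchange (sumTo N f) (sumTo N g) (f (suc N)) (g (suc N)))

sumTo-0 : ∀ N → sumTo N (λ _ → + 0) ≡ + 0
sumTo-0 zero    = refl
sumTo-0 (suc N) = cong (_+ℤ + 0) (sumTo-0 N)

sumTo-if : ∀ N b (f : ℕ → ℤ) → sumTo N (λ i → if b then f i else + 0) ≡ (if b then sumTo N f else + 0)
sumTo-if N true  f = refl
sumTo-if N false f = sumTo-0 N

sumTo-δ : ∀ N x (f : ℕ → ℤ) → sumTo N (λ i → if x ≡ᵇ i then f i else + 0) ≡ (if x ≤ᵇ N then f x else + 0)
sumTo-δ zero    zero    f = refl
sumTo-δ zero    (suc x) f = refl
sumTo-δ (suc N) x       f with <-cmp x (suc N)
... | tri< x<1+N x≢1+N _
  rewrite sumTo-δ N x f | ≡ᵇ-false x≢1+N | ≤ᵇ-true (≤-pred x<1+N) | ≤ᵇ-true (ℕₚ.<⇒≤ x<1+N)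
  = ℤₚ.+-identityʳ (f x)
... | tri≈ _ refl _
  rewrite sumTo-δ N x f | ≤ᵇ-false (n<1+n N) | ≡ᵇ-true (refl {x = x}) | ≤ᵇ-true (≤-refl {x})
  = ℤₚ.+-identityˡ (f x)
... | tri> _ x≢1+N 1+N<x
  rewrite sumTo-δ N x f | ≡ᵇ-false x≢1+N | ≤ᵇ-false 1+N<x | ≤ᵇ-false (ℕₚ.<-trans (n<1+n N) 1+N<x)
  = refl

if-∧-* : ∀ b b′ (c d : ℤ) →
  (if b ∧ b′ then c else + 0) *ℤ d ≡ (if b then (if b′ then c *ℤ d else + 0) else + 0)
if-∧-* true  true  c d = refl
if-∧-* true  false c d = ℤₚ.*-zeroˡ d
if-∧-* false b′    c d = ℤₚ.*-zeroˡ d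

if-*-if : ∀ b₁ b₂ b₃ b₄ (c d : ℤ) →
  (if b₁ then (if b₂ then c *ℤ (if b₃ ∧ b₄ then d else + 0) else + 0) else + 0)
  ≡ (if (b₁ ∧ b₃) ∧ (b₂ ∧ b₄) then c *ℤ d else + 0)
if-*-if true  true  true  true  c d = refl
if-*-if true  true  true  false c d = ℤₚ.*-zeroʳ c
if-*-if true  true  false b₄    c d = ℤₚ.*-zeroʳ c
if-*-if true  false true  b₄    c d = refl
if-*-if true  false false b₄    c d = refl
if-*-if false b₂    b₃    b₄    c d = refl

+≡ᵇ-split : ∀ x y a → ((x ≤ᵇ a) ∧ (y ≡ᵇ a ∸ x)) ≡ (x + y ≡ᵇ a)
+≡ᵇ-split zero    y a       = refl
+≡ᵇ-split (suc x) y zero    = refl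
+≡ᵇ-split (suc x) y (suc a) = trans (cong (_∧ (y ≡ᵇ a ∸ x)) (<ᵇ-suc x a)) (+≡ᵇ-split x y a)
  where
  <ᵇ-suc : ∀ x a → (x <ᵇ suc a) ≡ (x ≤ᵇ a)
  <ᵇ-suc zero    a = refl
  <ᵇ-suc (suc x) a = refl

⊛-cong : ∀ {f f′ g g′} → f ≐ f′ → g ≐ g′ → f ⊛ g ≐ f′ ⊛ g′
⊛-cong f≐f′ g≐g′ a n =
  sumTo-cong a λ a′ → sumTo-cong n λ n′ → cong₂ _*ℤ_ (f≐f′ a′ n′) (g≐g′ (a ∸ a′) (n ∸ n′))

sumTo²-+ : ∀ a n (F G : ℕ → ℕ → ℤ) →
  sumTo a (λ a′ → sumTo n (λ n′ → F a′ n′ +ℤ G a′ n′))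
  ≡ sumTo a (λ a′ → sumTo n (F a′)) +ℤ sumTo a (λ a′ → sumTo n (G a′))
sumTo²-+ a n F G = trans (sumTo-cong a λ a′ → sumTo-+ n (F a′) (G a′)) (sumTo-+ a _ _)

sumTo²-0 : ∀ a n (F : ℕ → ℕ → ℤ) → (∀ a′ n′ → F a′ n′ ≡ + 0) → sumTo a (λ a′ → sumTo n (F a′)) ≡ + 0
sumTo²-0 a n F F≡0 =
  trans (sumTo-cong a λ a′ → trans (sumTo-cong n (F≡0 a′)) (sumTo-0 n)) (sumTo-0 a)

⊛-distribʳ : ∀ f g h → (f ⊕ g) ⊛ h ≐ (f ⊛ h) ⊕ (g ⊛ h)
⊛-distribʳ f g h a n = trans
  (sumTo-cong a λ a′ → sumTo-cong n λ n′ → ℤₚ.*-distribʳ-+ (h (a ∸ a′) (n ∸ n′)) (f a′ n′) (g a′ n′))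
  (sumTo²-+ a n _ _)

⊛-distribˡ : ∀ f g h → f ⊛ (g ⊕ h) ≐ (f ⊛ g) ⊕ (f ⊛ h)
⊛-distribˡ f g h a n = trans
  (sumTo-cong a λ a′ → sumTo-cong n λ n′ → ℤₚ.*-distribˡ-+ (f a′ n′) (g (a ∸ a′) (n ∸ n′)) (h (a ∸ a′) (n ∸ n′)))
  (sumTo²-+ a n _ _)

⊛-zeroˡ : ∀ g → zeroᴾ ⊛ g ≐ zeroᴾ
⊛-zeroˡ g a n = sumTo²-0 a n _ λ a′ n′ → ℤₚ.*-zeroˡ (g (a ∸ a′) (n ∸ n′))

⊛-zeroʳ : ∀ f → f ⊛ zeroᴾ ≐ zeroᴾ
⊛-zeroʳ f a n = sumTo²-0 a n _ λ a′ n′ → ℤₚ.*-zeroʳ (f a′ n′)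

-- The ring of term lists

-- (c , a , n) stands for the monomial c z^a q^n, and a list for the sum of its terms.
Term : Set
Term = ℤ × ℕ × ℕ

⟦_⟧ₜ : Term → Poly
⟦ c , x , y ⟧ₜ a n = if (x ≡ᵇ a) ∧ (y ≡ᵇ n) then c else + 0

⟦_⟧ : List Term → Poly
⟦ []     ⟧ = zeroᴾ
⟦ t ∷ ts ⟧ = ⟦ t ⟧ₜ ⊕ ⟦ ts ⟧

infixl 7 _∙_

_∙_ : Term → Term → Term
(c , x , y) ∙ (d , x′ , y′) = c *ℤ d , x + x′ , y + y′

∙-comm : ∀ t u → t ∙ u ≡ u ∙ t
∙-comm (c , x , y) (d , x′ , y′) =
  cong₂ _,_ (ℤₚ.*-comm c d) (cong₂ _,_ (ℕₚ.+-comm x x′) (ℕₚ.+-comm y y′))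

∙-assoc : ∀ t u v → (t ∙ u) ∙ v ≡ t ∙ (u ∙ v)
∙-assoc (c , x , y) (d , x′ , y′) (e , x″ , y″) =
  cong₂ _,_ (ℤₚ.*-assoc c d e) (cong₂ _,_ (ℕₚ.+-assoc x x′ x″) (ℕₚ.+-assoc y y′ y″))

⊛-shiftˡ : ∀ c x y (g : Poly) a n →
  (⟦ c , x , y ⟧ₜ ⊛ g) a n
  ≡ (if x ≤ᵇ a then (if y ≤ᵇ n then c *ℤ g (a ∸ x) (n ∸ y) else + 0) else + 0)
⊛-shiftˡ c x y g a n = begin
  sumTo a (λ a′ → sumTo n (λ n′ → ⟦ c , x , y ⟧ₜ a′ n′ *ℤ g (a ∸ a′) (n ∸ n′)))
    ≡⟨ sumTo-cong a (λ a′ → sumTo-cong n λ n′ → if-∧-* (x ≡ᵇ a′) (y ≡ᵇ n′) c _) ⟩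
  sumTo a (λ a′ → sumTo n (λ n′ →
    if x ≡ᵇ a′ then (if y ≡ᵇ n′ then c *ℤ g (a ∸ a′) (n ∸ n′) else + 0) else + 0))
    ≡⟨ sumTo-cong a (λ a′ → trans (sumTo-if n (x ≡ᵇ a′) _)
                                  (cong (λ s → if x ≡ᵇ a′ then s else + 0) (sumTo-δ n y _))) ⟩
  sumTo a (λ a′ → if x ≡ᵇ a′ then (if y ≤ᵇ n then c *ℤ g (a ∸ a′) (n ∸ y) else + 0) else + 0)
    ≡⟨ sumTo-δ a x _ ⟩
  (if x ≤ᵇ a then (if y ≤ᵇ n then c *ℤ g (a ∸ x) (n ∸ y) else + 0) else + 0) ∎
  where open ≡-Reasoning

⊛-term : ∀ t u → ⟦ t ⟧ₜ ⊛ ⟦ u ⟧ₜ ≐ ⟦ t ∙ u ⟧ₜ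
⊛-term (c , x , y) (d , x′ , y′) a n = begin
  (⟦ c , x , y ⟧ₜ ⊛ ⟦ d , x′ , y′ ⟧ₜ) a n
    ≡⟨ ⊛-shiftˡ c x y ⟦ d , x′ , y′ ⟧ₜ a n ⟩
  (if x ≤ᵇ a then (if y ≤ᵇ n then c *ℤ ⟦ d , x′ , y′ ⟧ₜ (a ∸ x) (n ∸ y) else + 0) else + 0)
    ≡⟨ if-*-if (x ≤ᵇ a) (y ≤ᵇ n) (x′ ≡ᵇ a ∸ x) (y′ ≡ᵇ n ∸ y) c d ⟩
  (if ((x ≤ᵇ a) ∧ (x′ ≡ᵇ a ∸ x)) ∧ ((y ≤ᵇ n) ∧ (y′ ≡ᵇ n ∸ y)) then c *ℤ d else + 0)
    ≡⟨ cong₂ (λ b b′ → if b ∧ b′ then c *ℤ d else + 0) (+≡ᵇ-split x x′ a) (+≡ᵇ-split y y′ n) ⟩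
  ⟦ (c , x , y) ∙ (d , x′ , y′) ⟧ₜ a n ∎
  where open ≡-Reasoning

infixl 7 _⊠_
infix  8 ⊟_

_⊠_ : List Term → List Term → List Term
[]       ⊠ ys = []
(t ∷ xs) ⊠ ys = map (t ∙_) ys ++ xs ⊠ ys

negate : Term → Term
negate (c , x , y) = -ℤ c , x , y

⊟_ : List Term → List Term
⊟_ = map negate

1ₗ : List Term
1ₗ = (+ 1 , 0 , 0) ∷ []

⟦++⟧ : ∀ xs ys → ⟦ xs ++ ys ⟧ ≐ ⟦ xs ⟧ ⊕ ⟦ ys ⟧
⟦++⟧ []       ys a n = sym (ℤₚ.+-identityˡ (⟦ ys ⟧ a n))
⟦++⟧ (t ∷ xs) ys a n =
  trans (cong (⟦ t ⟧ₜ a n +ℤ_) (⟦++⟧ xs ys a n)) (sym (ℤₚ.+-assoc (⟦ t ⟧ₜ a n) _ _))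

⟦⊟⟧ : ∀ xs a n → ⟦ ⊟ xs ⟧ a n ≡ -ℤ ⟦ xs ⟧ a n
⟦⊟⟧ []       a n = refl
⟦⊟⟧ (t ∷ xs) a n =
  trans (cong₂ _+ℤ_ (⟦negate⟧ t) (⟦⊟⟧ xs a n)) (sym (ℤₚ.neg-distrib-+ (⟦ t ⟧ₜ a n) _))
  where
  ⟦negate⟧ : ∀ t → ⟦ negate t ⟧ₜ a n ≡ -ℤ ⟦ t ⟧ₜ a n
  ⟦negate⟧ (c , x , y) with (x ≡ᵇ a) ∧ (y ≡ᵇ n)
  ... | true  = refl
  ... | false = refl

⟦map∙⟧ : ∀ t ys → ⟦ map (t ∙_) ys ⟧ ≐ ⟦ t ⟧ₜ ⊛ ⟦ ys ⟧
⟦map∙⟧ t []       a n = sym (⊛-zeroʳ ⟦ t ⟧ₜ a n)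
⟦map∙⟧ t (u ∷ ys) a n =
  trans (cong₂ _+ℤ_ (sym (⊛-term t u a n)) (⟦map∙⟧ t ys a n)) (sym (⊛-distribˡ ⟦ t ⟧ₜ ⟦ u ⟧ₜ ⟦ ys ⟧ a n))

⟦⊠⟧ : ∀ xs ys → ⟦ xs ⊠ ys ⟧ ≐ ⟦ xs ⟧ ⊛ ⟦ ys ⟧
⟦⊠⟧ []       ys a n = sym (⊛-zeroˡ ⟦ ys ⟧ a n)
⟦⊠⟧ (t ∷ xs) ys a n = begin
  ⟦ map (t ∙_) ys ++ xs ⊠ ys ⟧ a n                 ≡⟨ ⟦++⟧ (map (t ∙_) ys) (xs ⊠ ys) a n ⟩
  ⟦ map (t ∙_) ys ⟧ a n +ℤ ⟦ xs ⊠ ys ⟧ a n         ≡⟨ cong₂ _+ℤ_ (⟦map∙⟧ t ys a n) (⟦⊠⟧ xs ys a n) ⟩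
  (⟦ t ⟧ₜ ⊛ ⟦ ys ⟧) a n +ℤ (⟦ xs ⟧ ⊛ ⟦ ys ⟧) a n  ≡⟨ sym (⊛-distribʳ ⟦ t ⟧ₜ ⟦ xs ⟧ ⟦ ys ⟧ a n) ⟩
  (⟦ t ∷ xs ⟧ ⊛ ⟦ ys ⟧) a n                        ∎
  where open ≡-Reasoning

⊛-comm-⟦⟧ₜ : ∀ t ys → ⟦ ys ⟧ ⊛ ⟦ t ⟧ₜ ≐ ⟦ t ⟧ₜ ⊛ ⟦ ys ⟧
⊛-comm-⟦⟧ₜ t []       a n = trans (⊛-zeroˡ ⟦ t ⟧ₜ a n) (sym (⊛-zeroʳ ⟦ t ⟧ₜ a n))
⊛-comm-⟦⟧ₜ t (u ∷ ys) a n = begin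
  ((⟦ u ⟧ₜ ⊕ ⟦ ys ⟧) ⊛ ⟦ t ⟧ₜ) a n                 ≡⟨ ⊛-distribʳ ⟦ u ⟧ₜ ⟦ ys ⟧ ⟦ t ⟧ₜ a n ⟩
  (⟦ u ⟧ₜ ⊛ ⟦ t ⟧ₜ) a n +ℤ (⟦ ys ⟧ ⊛ ⟦ t ⟧ₜ) a n  ≡⟨ cong₂ _+ℤ_ term-comm (⊛-comm-⟦⟧ₜ t ys a n) ⟩
  (⟦ t ⟧ₜ ⊛ ⟦ u ⟧ₜ) a n +ℤ (⟦ t ⟧ₜ ⊛ ⟦ ys ⟧) a n  ≡⟨ sym (⊛-distribˡ ⟦ t ⟧ₜ ⟦ u ⟧ₜ ⟦ ys ⟧ a n) ⟩
  (⟦ t ⟧ₜ ⊛ (⟦ u ⟧ₜ ⊕ ⟦ ys ⟧)) a n                 ∎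
  where
  open ≡-Reasoning
  term-comm : (⟦ u ⟧ₜ ⊛ ⟦ t ⟧ₜ) a n ≡ (⟦ t ⟧ₜ ⊛ ⟦ u ⟧ₜ) a n
  term-comm = trans (⊛-term u t a n) (trans (cong (λ v → ⟦ v ⟧ₜ a n) (∙-comm u t)) (sym (⊛-term t u a n)))

⊛-comm-⟦⟧ : ∀ xs ys → ⟦ xs ⟧ ⊛ ⟦ ys ⟧ ≐ ⟦ ys ⟧ ⊛ ⟦ xs ⟧
⊛-comm-⟦⟧ []       ys a n = trans (⊛-zeroˡ ⟦ ys ⟧ a n) (sym (⊛-zeroʳ ⟦ ys ⟧ a n))
⊛-comm-⟦⟧ (t ∷ xs) ys a n = begin
  ((⟦ t ⟧ₜ ⊕ ⟦ xs ⟧) ⊛ ⟦ ys ⟧) a n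
    ≡⟨ ⊛-distribʳ ⟦ t ⟧ₜ ⟦ xs ⟧ ⟦ ys ⟧ a n ⟩
  (⟦ t ⟧ₜ ⊛ ⟦ ys ⟧) a n +ℤ (⟦ xs ⟧ ⊛ ⟦ ys ⟧) a n
    ≡⟨ cong₂ _+ℤ_ (sym (⊛-comm-⟦⟧ₜ t ys a n)) (⊛-comm-⟦⟧ xs ys a n) ⟩
  (⟦ ys ⟧ ⊛ ⟦ t ⟧ₜ) a n +ℤ (⟦ ys ⟧ ⊛ ⟦ xs ⟧) a n
    ≡⟨ sym (⊛-distribˡ ⟦ ys ⟧ ⟦ t ⟧ₜ ⟦ xs ⟧ a n) ⟩
  (⟦ ys ⟧ ⊛ (⟦ t ⟧ₜ ⊕ ⟦ xs ⟧)) a n ∎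
  where open ≡-Reasoning

⊠-distribʳ : ∀ xs ys zs → (xs ++ ys) ⊠ zs ≡ xs ⊠ zs ++ ys ⊠ zs
⊠-distribʳ []       ys zs = refl
⊠-distribʳ (t ∷ xs) ys zs =
  trans (cong (map (t ∙_) zs ++_) (⊠-distribʳ xs ys zs)) (sym (Listₚ.++-assoc (map (t ∙_) zs) _ _))

map∙-⊠ : ∀ t ys zs → map (t ∙_) ys ⊠ zs ≡ map (t ∙_) (ys ⊠ zs)
map∙-⊠ t []       zs = refl
map∙-⊠ t (u ∷ ys) zs = begin
  map ((t ∙ u) ∙_) zs ++ map (t ∙_) ys ⊠ zs
    ≡⟨ cong₂ _++_ (Listₚ.map-cong (∙-assoc t u) zs) (map∙-⊠ t ys zs) ⟩
  map (λ v → t ∙ (u ∙ v)) zs ++ map (t ∙_) (ys ⊠ zs)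
    ≡⟨ cong (_++ map (t ∙_) (ys ⊠ zs)) (Listₚ.map-∘ zs) ⟩
  map (t ∙_) (map (u ∙_) zs) ++ map (t ∙_) (ys ⊠ zs)
    ≡⟨ sym (Listₚ.map-++ (t ∙_) (map (u ∙_) zs) (ys ⊠ zs)) ⟩
  map (t ∙_) (map (u ∙_) zs ++ ys ⊠ zs) ∎
  where open ≡-Reasoning

⊠-assoc : ∀ xs ys zs → (xs ⊠ ys) ⊠ zs ≡ xs ⊠ (ys ⊠ zs)
⊠-assoc []       ys zs = refl
⊠-assoc (t ∷ xs) ys zs = begin
  (map (t ∙_) ys ++ xs ⊠ ys) ⊠ zs          ≡⟨ ⊠-distribʳ (map (t ∙_) ys) (xs ⊠ ys) zs ⟩
  map (t ∙_) ys ⊠ zs ++ (xs ⊠ ys) ⊠ zs     ≡⟨ cong₂ _++_ (map∙-⊠ t ys zs) (⊠-assoc xs ys zs) ⟩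
  map (t ∙_) (ys ⊠ zs) ++ xs ⊠ (ys ⊠ zs)   ∎
  where open ≡-Reasoning

⊠-identityˡ : ∀ xs → 1ₗ ⊠ xs ≡ xs
⊠-identityˡ xs = trans (Listₚ.++-identityʳ _) (trans (Listₚ.map-cong one∙ xs) (Listₚ.map-id xs))
  where
  one∙ : ∀ t → (+ 1 , 0 , 0) ∙ t ≡ t
  one∙ (c , x , y) = cong (_, x , y) (ℤₚ.*-identityˡ c)

infix 4 _≈_

record _≈_ (xs ys : List Term) : Set where
  constructor mk≈
  field ⟦≈⟧ : ⟦ xs ⟧ ≐ ⟦ ys ⟧

open _≈_ using (⟦≈⟧)

≡⇒≈ : ∀ {xs ys} → xs ≡ ys → xs ≈ ys
≡⇒≈ refl = mk≈ λ _ _ → refl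

termRing : CommutativeRing 0ℓ 0ℓ
termRing = record
  { Carrier = List Term
  ; _≈_ = _≈_
  ; _+_ = _++_
  ; _*_ = _⊠_
  ; -_ = ⊟_
  ; 0# = []
  ; 1# = 1ₗ
  ; isCommutativeRing = record
    { isRing = record
      { +-isAbelianGroup = record
        { isGroup = record
          { isMonoid = record
            { isSemigroup = record
              { isMagma = record { isEquivalence = isEquivalence ; ∙-cong = ++-cong }
              ; assoc = λ xs ys zs → ≡⇒≈ (Listₚ.++-assoc xs ys zs)
              }
            ; identity = (λ _ → ≈-refl) , λ xs → ≡⇒≈ (Listₚ.++-identityʳ xs)
            }
          ; inverse = ⊟-inverseˡ , (λ xs → ≈-trans (++-comm xs (⊟ xs)) (⊟-inverseˡ xs))
          ; ⁻¹-cong = ⊟-cong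
          }
        ; comm = ++-comm
        }
      ; *-cong = ⊠-cong
      ; *-assoc = λ xs ys zs → ≡⇒≈ (⊠-assoc xs ys zs)
      ; *-identity = (λ xs → ≡⇒≈ (⊠-identityˡ xs))
                   , (λ xs → ≈-trans (⊠-comm xs 1ₗ) (≡⇒≈ (⊠-identityˡ xs)))
      ; distrib = ⊠-distribˡ , λ xs ys zs → ≡⇒≈ (⊠-distribʳ ys zs xs)
      }
    ; *-comm = ⊠-comm
    }
  }
  where
  ≈-refl : ∀ {xs} → xs ≈ xs
  ≈-refl = mk≈ λ _ _ → refl

  ≈-trans : ∀ {xs ys zs} → xs ≈ ys → ys ≈ zs → xs ≈ zs
  ≈-trans (mk≈ p) (mk≈ q) = mk≈ λ a n → trans (p a n) (q a n)

  isEquivalence : IsEquivalence _≈_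
  isEquivalence = record
    { refl = ≈-refl ; sym = λ (mk≈ p) → mk≈ λ a n → sym (p a n) ; trans = ≈-trans }

  ++-cong : ∀ {xs xs′ ys ys′} → xs ≈ xs′ → ys ≈ ys′ → xs ++ ys ≈ xs′ ++ ys′
  ++-cong {xs} {xs′} {ys} {ys′} (mk≈ p) (mk≈ q) = mk≈ λ a n →
    trans (⟦++⟧ xs ys a n) (trans (cong₂ _+ℤ_ (p a n) (q a n)) (sym (⟦++⟧ xs′ ys′ a n)))

  ++-comm : ∀ xs ys → xs ++ ys ≈ ys ++ xs
  ++-comm xs ys = mk≈ λ a n →
    trans (⟦++⟧ xs ys a n) (trans (ℤₚ.+-comm (⟦ xs ⟧ a n) _) (sym (⟦++⟧ ys xs a n)))

  ⊟-cong : ∀ {xs ys} → xs ≈ ys → ⊟ xs ≈ ⊟ ys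
  ⊟-cong {xs} {ys} (mk≈ p) = mk≈ λ a n →
    trans (⟦⊟⟧ xs a n) (trans (cong -ℤ_ (p a n)) (sym (⟦⊟⟧ ys a n)))

  ⊟-inverseˡ : ∀ xs → ⊟ xs ++ xs ≈ []
  ⊟-inverseˡ xs = mk≈ λ a n →
    trans (⟦++⟧ (⊟ xs) xs a n) (trans (cong (_+ℤ ⟦ xs ⟧ a n) (⟦⊟⟧ xs a n)) (ℤₚ.+-inverseˡ (⟦ xs ⟧ a n)))

  ⊠-cong : ∀ {xs xs′ ys ys′} → xs ≈ xs′ → ys ≈ ys′ → xs ⊠ ys ≈ xs′ ⊠ ys′
  ⊠-cong {xs} {xs′} {ys} {ys′} (mk≈ p) (mk≈ q) = mk≈ λ a n →
    trans (⟦⊠⟧ xs ys a n) (trans (⊛-cong p q a n) (sym (⟦⊠⟧ xs′ ys′ a n)))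

  ⊠-comm : ∀ xs ys → xs ⊠ ys ≈ ys ⊠ xs
  ⊠-comm xs ys = mk≈ λ a n →
    trans (⟦⊠⟧ xs ys a n) (trans (⊛-comm-⟦⟧ xs ys a n) (sym (⟦⊠⟧ ys xs a n)))

  ⊠-distribˡ : ∀ xs ys zs → xs ⊠ (ys ++ zs) ≈ xs ⊠ ys ++ xs ⊠ zs
  ⊠-distribˡ xs ys zs = ≈-trans (⊠-comm xs (ys ++ zs))
    (≈-trans (≡⇒≈ (⊠-distribʳ ys zs xs)) (++-cong (⊠-comm ys xs) (⊠-comm zs xs)))

termACR : AlmostCommutativeRing 0ℓ 0ℓ
termACR = fromCommutativeRing termRing

module ≈-Reasoning = Relation.Binary.Reasoning.Setoid (CommutativeRing.setoid termRing)
module TermRing = CommutativeRing termRing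

-- With ℤ rather than the term lists as coefficients, the solver can cancel opposite terms.
constant : ℤ → List Term
constant c = (c , 0 , 0) ∷ []

constant-morphism : ℤ.+-*-rawRing -Raw-AlmostCommutative⟶ termACR
constant-morphism = record
  { ⟦_⟧    = constant
  ; +-homo = λ c d → mk≈ λ a n → +-homo c d ((0 ≡ᵇ a) ∧ (0 ≡ᵇ n))
  ; *-homo = λ _ _ → TermRing.refl
  ; -‿homo = λ _ → TermRing.refl
  ; 0-homo = mk≈ λ a n → 0-homo ((0 ≡ᵇ a) ∧ (0 ≡ᵇ n))
  ; 1-homo = TermRing.refl
  }
  where
  +-homo : ∀ c d b → (if b then c +ℤ d else + 0) +ℤ + 0
                     ≡ (if b then c else + 0) +ℤ ((if b then d else + 0) +ℤ + 0)
  +-homo c d true  = trans (ℤₚ.+-identityʳ (c +ℤ d)) (cong (c +ℤ_) (sym (ℤₚ.+-identityʳ d)))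
  +-homo c d false = refl

  0-homo : ∀ b → (if b then + 0 else + 0) +ℤ + 0 ≡ + 0
  0-homo true  = refl
  0-homo false = refl

constant-≟ : WeaklyDecidable (Induced-equivalence constant-morphism)
constant-≟ c d with c ℤ.≟ d
... | yes refl = just TermRing.refl
... | no _     = nothing

open Algebra.Solver.Ring ℤ.+-*-rawRing termACR constant-morphism constant-≟
  using (solve; _:=_; _:+_; _:*_; _:-_; con)

mon : ℕ → ℕ → List Term
mon a n = (+ 1 , a , n) ∷ []

q^ : ℕ → List Term
q^ = mon 0

⟦mon⟧ : ∀ a n → ⟦ mon a n ⟧ ≐ mono a n
⟦mon⟧ a n a′ n′ = ℤₚ.+-identityʳ (mono a n a′ n′)

pair : ℕ → ℕ → List Term
pair r e = mon r e ++ mon (suc r) e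

⟦pair⟧ : ∀ r e → ⟦ pair r e ⟧ ≐ mono r e ⊕ mono (suc r) e
⟦pair⟧ r e a n = cong (mono r e a n +ℤ_) (⟦mon⟧ (suc r) e a n)

pochFactor : ℕ → ℕ → List Term
pochFactor k N = 1ₗ ++ ⊟ q^ (k * N)

pochₗ : ℕ → ℕ → List Term
pochₗ k zero    = 1ₗ
pochₗ k (suc N) = pochₗ k N ⊠ pochFactor k (suc N)

⟦pochₗ⟧ : ∀ k N → ⟦ pochₗ k N ⟧ ≐ poch k N
⟦pochₗ⟧ k zero    = ⟦mon⟧ 0 0
⟦pochₗ⟧ k (suc N) a n = trans (⟦⊠⟧ (pochₗ k N) _ a n) (⊛-cong (⟦pochₗ⟧ k N) ⟦1-q^⟧ a n)
  where
  ⟦1-q^⟧ : ⟦ pochFactor k (suc N) ⟧ ≐ one ⊖ mono 0 (k * suc N)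
  ⟦1-q^⟧ a n = cong (one a n +ℤ_) (trans (⟦⊟⟧ (q^ (k * suc N)) a n) (cong -ℤ_ (⟦mon⟧ 0 (k * suc N) a n)))

⟦⊠⟧-≐ : ∀ xs ys {f g} → ⟦ xs ⟧ ≐ f → ⟦ ys ⟧ ≐ g → ⟦ xs ⊠ ys ⟧ ≐ f ⊛ g
⟦⊠⟧-≐ xs ys xs≐f ys≐g a n = trans (⟦⊠⟧ xs ys a n) (⊛-cong xs≐f ys≐g a n)

map∙-cong : ∀ t {xs ys} → xs ≈ ys → map (t ∙_) xs ≈ (t ∷ []) ⊠ ys
map∙-cong t {xs} xs≈ys =
  TermRing.trans (≡⇒≈ (sym (Listₚ.++-identityʳ (map (t ∙_) xs)))) (TermRing.*-congˡ {t ∷ []} xs≈ys)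

concatMap-≈[] : ∀ {A : Set} (h : A → List Term) {xs} → All (λ x → h x ≈ []) xs → concatMap h xs ≈ []
concatMap-≈[] h []           = TermRing.refl
concatMap-≈[] h (hx≈[] ∷ hs) = TermRing.+-cong hx≈[] (concatMap-≈[] h hs)

concatMap-applyUpTo-single : ∀ (h : ℕ → List Term) f J s → s < J → (∀ i → i ≢ s → h (f i) ≈ []) →
  concatMap h (applyUpTo f J) ≈ h (f s)
concatMap-applyUpTo-single h f (suc J) zero _ h≈[] = TermRing.trans
  (TermRing.+-cong (TermRing.refl {h (f 0)})
                   (concatMap-≈[] h (applyUpTo⁺₂ (f ∘ suc) J λ i → h≈[] (suc i) λ ())))
  (TermRing.+-identityʳ (h (f 0)))
concatMap-applyUpTo-single h f (suc J) (suc s) (s≤s s<J) h≈[] = TermRing.+-cong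
  (h≈[] 0 λ ())
  (concatMap-applyUpTo-single h (f ∘ suc) J s s<J λ i i≢s → h≈[] (suc i) (i≢s ∘ ℕₚ.suc-injective))

module _ (k : ℕ) where

  -- chainGF k M s enumerates the lists λ₀ … λ_M with |λ₀| = s + 1 and λ_M ∈ {1, 1̄} in which each
  -- part has the size of the next one, or one more if it is overlined, and an overlined λ_i is
  -- followed by a multiple of k parts.
  chainGF : ℕ → ℕ → List Term
  chainGF zero    zero    = pair 0 1
  chainGF zero    (suc s) = []
  chainGF (suc M) zero    = q^ 1 ⊠ chainGF M zero
  chainGF (suc M) (suc s) =
    q^ (2 + s) ⊠ chainGF M (suc s) ++ (if ⌊ k ∣? suc M ⌋ then mon 1 (2 + s) ⊠ chainGF M s else [])

  chainGF-zero : ∀ M → chainGF M 0 ≡ pair 0 (suc M)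
  chainGF-zero zero    = refl
  chainGF-zero (suc M) = cong (q^ 1 ⊠_) (chainGF-zero M)

  chainGF-∤ : ∀ M s → ¬ k ∣ suc M → chainGF (suc M) s ≈ q^ (suc s) ⊠ chainGF M s
  chainGF-∤ M zero    _   = TermRing.refl
  chainGF-∤ M (suc s) k∤ rewrite ⌊⌋-false (k ∣? suc M) k∤ = TermRing.+-identityʳ _

  chainGF-∣ : ∀ M s → k ∣ suc M →
    chainGF (suc M) (suc s) ≡ q^ (2 + s) ⊠ chainGF M (suc s) ++ mon 1 (2 + s) ⊠ chainGF M s
  chainGF-∣ M s k∣ rewrite ⌊⌋-true (k ∣? suc M) k∣ = refl

-- Generating functions of BL-overpartitions

partTerm : Part → Term
partTerm p = + 1 , (if ov p then 1 else 0) , size p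

weightTerm : List Part → Term
weightTerm l = + 1 , numOv l , weight l

gf : (List Part → Bool) → List (List Part) → List Term
gf P ls = map weightTerm (filterᵇ P ls)

gf-count : ∀ P ls a n →
  + length (filterᵇ (λ l → P l ∧ (numOv l ≡ᵇ a) ∧ (weight l ≡ᵇ n)) ls) ≡ ⟦ gf P ls ⟧ a n
gf-count P []       a n = refl
gf-count P (l ∷ ls) a n with P l
... | false = gf-count P ls a n
... | true with (numOv l ≡ᵇ a) ∧ (weight l ≡ᵇ n)
...   | true  = cong (+ 1 +ℤ_) (gf-count P ls a n)
...   | false = trans (gf-count P ls a n) (sym (ℤₚ.+-identityˡ _))

gf-++ : ∀ P xs ys → gf P (xs ++ ys) ≡ gf P xs ++ gf P ys
gf-++ P []       ys = refl
gf-++ P (l ∷ xs) ys with P l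
... | true  = cong (weightTerm l ∷_) (gf-++ P xs ys)
... | false = gf-++ P xs ys

gf-map-∷ : ∀ P p ls → gf P (map (p ∷_) ls) ≡ map (partTerm p ∙_) (gf (λ l → P (p ∷ l)) ls)
gf-map-∷ P p []       = refl
gf-map-∷ P p (l ∷ ls) with P (p ∷ l)
... | true  = cong (weightTerm (p ∷ l) ∷_) (gf-map-∷ P p ls)
... | false = gf-map-∷ P p ls

gf-cong : ∀ {P Q} ls → All (λ l → P l ≡ Q l) ls → gf P ls ≡ gf Q ls
gf-cong         []       []       = refl
gf-cong {P} {Q} (l ∷ ls) (e ∷ es) with P l | Q l | e
... | true  | .true  | refl = cong (weightTerm l ∷_) (gf-cong ls es)
... | false | .false | refl = gf-cong ls es

gf-const : ∀ b P ls → gf (λ l → b ∧ P l) ls ≡ (if b then gf P ls else [])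
gf-const true  P ls       = refl
gf-const false P []       = refl
gf-const false P (l ∷ ls) = gf-const false P ls

candidates-length : ∀ M j → All (λ l → length l ≡ M) (candidates M j)
candidates-length zero    j = refl ∷ []
candidates-length (suc M) j =
  concat⁺ (map⁺ (All.universal (λ _ → map⁺ (All.map (cong suc) (candidates-length M j))) (partsUpTo j)))

gf-candidates-suc : ∀ P M j → gf P (candidates (suc M) j)
  ≡ concatMap (λ p → map (partTerm p ∙_) (gf (λ l → P (p ∷ l)) (candidates M j))) (partsUpTo j)
gf-candidates-suc P M j =
  trans (gf-concatMap (partsUpTo j)) (Listₚ.concatMap-cong (λ p → gf-map-∷ P p (candidates M j)) (partsUpTo j))
  where
  gf-concatMap : ∀ ps → gf P (concatMap (λ p → map (p ∷_) (candidates M j)) ps)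
                        ≡ concatMap (λ p → gf P (map (p ∷_) (candidates M j))) ps
  gf-concatMap []       = refl
  gf-concatMap (p ∷ ps) = trans (gf-++ P (map (p ∷_) (candidates M j)) _) (cong (_ ++_) (gf-concatMap ps))

valid : ℕ → List Part → Bool
valid k l = isOverpartition l ∧ isLk k l ∧ blChain l

-- The conditions between consecutive parts x and y of a list in which M parts follow y.
link : ℕ → Part → Part → ℕ → Bool
link k x y M = (1 ≤ᵇ size x) ∧ (size y ≤ᵇ size x) ∧ (ov x ⇒ᵇ (size y <ᵇ size x)) ∧ (ov x ⇒ᵇ ⌊ k ∣? suc M ⌋)
             ∧ (size x ≤ᵇ size y + 1) ∧ (not (ov x) ⇒ᵇ (size x <ᵇ size y + 1))

valid-∷∷ : ∀ k x y ys → valid k (x ∷ y ∷ ys) ≡ link k x y (length ys) ∧ valid k (y ∷ ys)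
valid-∷∷ k x y ys = ∧-solve 9 (λ a₁ a₂ a₃ v₁ b₁ v₂ c₁ c₂ v₃ →
    (a₁ ∧ₑ a₂ ∧ₑ a₃ ∧ₑ v₁) ∧ₑ (b₁ ∧ₑ v₂) ∧ₑ (c₁ ∧ₑ c₂ ∧ₑ v₃)
    ⊜ (a₁ ∧ₑ a₂ ∧ₑ a₃ ∧ₑ b₁ ∧ₑ c₁ ∧ₑ c₂) ∧ₑ (v₁ ∧ₑ v₂ ∧ₑ v₃)) refl
  (1 ≤ᵇ size x) (size y ≤ᵇ size x) (ov x ⇒ᵇ (size y <ᵇ size x)) (isOverpartition (y ∷ ys))
  (ov x ⇒ᵇ ⌊ k ∣? suc (length ys) ⌋) (isLk k (y ∷ ys))
  (size x ≤ᵇ size y + 1) (not (ov x) ⇒ᵇ (size x <ᵇ size y + 1)) (blChain (y ∷ ys))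

inBL-∷ : ∀ k j p l → inBL k (suc (length l)) j (p ∷ l) ≡ ((size p ≡ᵇ j) ∧ ov p) ∧ valid k (p ∷ l)
inBL-∷ k j p l rewrite ≡ᵇ-true (refl {x = length l}) =
  ∧-solve 4 (λ o b c f → o ∧ₑ b ∧ₑ c ∧ₑ f ⊜ f ∧ₑ o ∧ₑ b ∧ₑ c) refl
  (isOverpartition (p ∷ l)) (isLk k (p ∷ l)) (blChain (p ∷ l)) ((size p ≡ᵇ j) ∧ ov p)

valid-[_] : ∀ k s b → valid k ((suc s , b) ∷ []) ≡ (s ≡ᵇ 0)
valid-[ k ] s b rewrite ⌊⌋-true (k ∣? 0) (k ∣0) with b | s
... | false | zero  = refl
... | false | suc _ = refl
... | true  | zero  = refl
... | true  | suc _ = refl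

link-plain : ∀ k s t b M → link k (suc s , false) (suc t , b) M ≡ (t ≡ᵇ s)
link-plain k s t b M rewrite ℕₚ.+-comm t 1 = same-size t s
  where
  same-size : ∀ t s → ((t <ᵇ suc s) ∧ (s <ᵇ suc (suc t)) ∧ (s <ᵇ suc t)) ≡ (t ≡ᵇ s)
  same-size zero    zero          = refl
  same-size zero    (suc zero)    = refl
  same-size zero    (suc (suc s)) = refl
  same-size (suc t) zero          = refl
  same-size (suc t) (suc s)       = same-size t s

link-overlined : ∀ k s t b M → link k (suc s , true) (suc t , b) M ≡ (suc t ≡ᵇ s) ∧ ⌊ k ∣? suc M ⌋
link-overlined k s t b M rewrite ℕₚ.+-comm t 1 = one-less t s ⌊ k ∣? suc M ⌋
  where
  one-less : ∀ t s D → ((t <ᵇ suc s) ∧ (t <ᵇ s) ∧ D ∧ (s <ᵇ suc (suc t)) ∧ true) ≡ ((suc t ≡ᵇ s) ∧ D)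
  one-less zero    zero          D     = refl
  one-less zero    (suc zero)    true  = refl
  one-less zero    (suc zero)    false = refl
  one-less zero    (suc (suc s)) true  = refl
  one-less zero    (suc (suc s)) false = refl
  one-less (suc t) zero          D     = refl
  one-less (suc t) (suc s)       D     = one-less t s D

concatMap-partsUpTo : ∀ (h : Part → List Term) j →
  concatMap h (partsUpTo j)
  ≡ concatMap (λ t → h (suc t , false) ++ (h (suc t , true) ++ [])) (applyUpTo (λ i → i) j)
concatMap-partsUpTo h j = go (applyUpTo (λ i → i) j)
  where
  sizes : ℕ → List Part
  sizes t = (suc t , false) ∷ (suc t , true) ∷ []
  go : ∀ ts → concatMap h (concatMap sizes ts) ≡ concatMap (concatMap h ∘ sizes) ts
  go []       = refl
  go (t ∷ ts) =
    trans (Listₚ.concatMap-++ h (sizes t) (concatMap sizes ts)) (cong (concatMap h (sizes t) ++_) (go ts))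

concatMap-partsUpTo-≈[] : ∀ (h : Part → List Term) j → (∀ t b → h (suc t , b) ≈ []) →
  concatMap h (partsUpTo j) ≈ []
concatMap-partsUpTo-≈[] h j h≈[] = TermRing.trans (≡⇒≈ (concatMap-partsUpTo h j))
  (concatMap-≈[] _ (applyUpTo⁺₂ (λ i → i) j λ t →
    TermRing.+-cong (h≈[] t false) (TermRing.+-cong (h≈[] t true) TermRing.refl)))

concatMap-partsUpTo-single : ∀ (h : Part → List Term) j s → s < j → (∀ t b → t ≢ s → h (suc t , b) ≈ []) →
  concatMap h (partsUpTo j) ≈ h (suc s , false) ++ h (suc s , true)
concatMap-partsUpTo-single h j s s<j h≈[] = begin
  concatMap h (partsUpTo j)
    ≡⟨ concatMap-partsUpTo h j ⟩
  concatMap (λ t → h (suc t , false) ++ (h (suc t , true) ++ [])) (applyUpTo (λ i → i) j)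
    ≈⟨ concatMap-applyUpTo-single _ (λ i → i) j s s<j
         (λ t t≢s → TermRing.+-cong (h≈[] t false t≢s) (TermRing.+-cong (h≈[] t true t≢s) TermRing.refl)) ⟩
  h (suc s , false) ++ (h (suc s , true) ++ [])
    ≡⟨ cong (h (suc s , false) ++_) (Listₚ.++-identityʳ (h (suc s , true))) ⟩
  h (suc s , false) ++ h (suc s , true) ∎
  where open ≈-Reasoning

module Tails (k j : ℕ) where

  tailGF : ℕ → Part → List Term
  tailGF M x = gf (λ l → valid k (x ∷ l)) (candidates M j)

  headedGF : ℕ → Part → List Term
  headedGF M x = map (partTerm x ∙_) (tailGF M x)

  sizeGF : ℕ → ℕ → List Term
  sizeGF M s = headedGF M (suc s , false) ++ headedGF M (suc s , true)

  guardedGF : ℕ → Bool → Part → List Term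
  guardedGF M c y = map (partTerm y ∙_) (if c then tailGF M y else [])

  linkedGF : ℕ → Part → Part → List Term
  linkedGF M x y = guardedGF M (link k x y M) y

  linkedGF-by : ∀ M x y {c} → link k x y M ≡ c → linkedGF M x y ≡ guardedGF M c y
  linkedGF-by M x y = cong (λ c → guardedGF M c y)

  tailGF-suc : ∀ M x → tailGF (suc M) x ≡ concatMap (linkedGF M x) (partsUpTo j)
  tailGF-suc M x = trans (gf-candidates-suc _ M j) (Listₚ.concatMap-cong (λ y → cong (map (partTerm y ∙_))
    (trans (gf-cong (candidates M j) (All.map (λ {l} → linked y l) (candidates-length M j)))
           (gf-const (link k x y M) (λ l → valid k (y ∷ l)) (candidates M j)))) (partsUpTo j))
    where
    linked : ∀ y l → length l ≡ M → valid k (x ∷ y ∷ l) ≡ link k x y M ∧ valid k (y ∷ l)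
    linked y l refl = valid-∷∷ k x y l

  tailGF-plain : ∀ M s → s < j → tailGF (suc M) (suc s , false) ≈ sizeGF M s
  tailGF-plain M s s<j = begin
    tailGF (suc M) (suc s , false)
      ≡⟨ tailGF-suc M (suc s , false) ⟩
    concatMap (linkedGF M (suc s , false)) (partsUpTo j)
      ≈⟨ concatMap-partsUpTo-single (linkedGF M (suc s , false)) j s s<j
           (λ t b t≢s → ≡⇒≈ (linkedGF-by M (suc s , false) (suc t , b)
                                (trans (link-plain k s t b M) (≡ᵇ-false t≢s)))) ⟩
    linkedGF M (suc s , false) (suc s , false) ++ linkedGF M (suc s , false) (suc s , true)
      ≡⟨ cong₂ _++_ (linkedGF-by M (suc s , false) (suc s , false) (same false))
                    (linkedGF-by M (suc s , false) (suc s , true) (same true)) ⟩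
    sizeGF M s ∎
    where
    open ≈-Reasoning
    same : ∀ b → link k (suc s , false) (suc s , b) M ≡ true
    same b = trans (link-plain k s s b M) (≡ᵇ-true {s} refl)

  tailGF-overlined : ∀ M s → s < j → tailGF (suc M) (2 + s , true) ≈ (if ⌊ k ∣? suc M ⌋ then sizeGF M s else [])
  tailGF-overlined M s s<j = begin
    tailGF (suc M) (2 + s , true)
      ≡⟨ tailGF-suc M (2 + s , true) ⟩
    concatMap (linkedGF M (2 + s , true)) (partsUpTo j)
      ≈⟨ concatMap-partsUpTo-single (linkedGF M (2 + s , true)) j s s<j
           (λ t b t≢s → ≡⇒≈ (linkedGF-by M (2 + s , true) (suc t , b)
                                (trans (link-overlined k (suc s) t b M) (cong (_∧ D) (≡ᵇ-false t≢s))))) ⟩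
    linkedGF M (2 + s , true) (suc s , false) ++ linkedGF M (2 + s , true) (suc s , true)
      ≡⟨ cong₂ _++_ (linkedGF-by M (2 + s , true) (suc s , false) (one-less false))
                    (linkedGF-by M (2 + s , true) (suc s , true) (one-less true)) ⟩
    guardedGF M D (suc s , false) ++ guardedGF M D (suc s , true)
      ≡⟨ if-++ D ⟩
    (if D then sizeGF M s else []) ∎
    where
    open ≈-Reasoning
    D = ⌊ k ∣? suc M ⌋
    one-less : ∀ b → link k (2 + s , true) (suc s , b) M ≡ D
    one-less b = trans (link-overlined k (suc s) s b M) (cong (_∧ D) (≡ᵇ-true {s} refl))
    if-++ : ∀ D → guardedGF M D (suc s , false) ++ guardedGF M D (suc s , true) ≡ (if D then sizeGF M s else [])
    if-++ true  = refl
    if-++ false = refl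

  tailGF-overlined-1 : ∀ M → tailGF (suc M) (1 , true) ≈ []
  tailGF-overlined-1 M = TermRing.trans (≡⇒≈ (tailGF-suc M (1 , true)))
    (concatMap-partsUpTo-≈[] (linkedGF M (1 , true)) j λ t b →
      ≡⇒≈ (linkedGF-by M (1 , true) (suc t , b) (link-overlined k 0 t b M)))

  tailGF-0 : ∀ s b → tailGF 0 (suc s , b) ≡ (if s ≡ᵇ 0 then weightTerm [] ∷ [] else [])
  tailGF-0 s b with valid k ((suc s , b) ∷ []) | valid-[ k ] s b
  ... | true  | e = cong (λ c → if c then weightTerm [] ∷ [] else []) e
  ... | false | e = cong (λ c → if c then weightTerm [] ∷ [] else []) e

  sizeGF≈chainGF : ∀ M s → s < j → sizeGF M s ≈ chainGF k M s
  sizeGF≈chainGF zero s _ = ≡⇒≈ (trans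
    (cong₂ (λ u v → map (partTerm (suc s , false) ∙_) u ++ map (partTerm (suc s , true) ∙_) v)
           (tailGF-0 s false) (tailGF-0 s true))
    (single-part s))
    where
    single-part : ∀ s → map (partTerm (suc s , false) ∙_) (if s ≡ᵇ 0 then weightTerm [] ∷ [] else [])
                      ++ map (partTerm (suc s , true) ∙_) (if s ≡ᵇ 0 then weightTerm [] ∷ [] else [])
                      ≡ chainGF k 0 s
    single-part zero    = refl
    single-part (suc s) = refl
  sizeGF≈chainGF (suc M) zero 0<j = begin
    headedGF (suc M) (1 , false) ++ headedGF (suc M) (1 , true)
      ≈⟨ TermRing.+-cong (map∙-cong (partTerm (1 , false)) (tailGF-plain M 0 0<j))
                         (map∙-cong (partTerm (1 , true)) (tailGF-overlined-1 M)) ⟩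
    q^ 1 ⊠ sizeGF M 0 ++ mon 1 1 ⊠ []
      ≈⟨ TermRing.+-cong (TermRing.*-congˡ {q^ 1} (sizeGF≈chainGF M 0 0<j)) (TermRing.zeroʳ (mon 1 1)) ⟩
    q^ 1 ⊠ chainGF k M 0 ++ []
      ≈⟨ TermRing.+-identityʳ (q^ 1 ⊠ chainGF k M 0) ⟩
    chainGF k (suc M) 0 ∎
    where open ≈-Reasoning
  sizeGF≈chainGF (suc M) (suc s) 1+s<j = begin
    headedGF (suc M) (2 + s , false) ++ headedGF (suc M) (2 + s , true)
      ≈⟨ TermRing.+-cong (map∙-cong (partTerm (2 + s , false)) (tailGF-plain M (suc s) 1+s<j))
                         (map∙-cong (partTerm (2 + s , true)) (tailGF-overlined M s s<j)) ⟩
    q^ (2 + s) ⊠ sizeGF M (suc s) ++ mon 1 (2 + s) ⊠ (if D then sizeGF M s else [])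
      ≈⟨ TermRing.+-cong (TermRing.*-congˡ {q^ (2 + s)} (sizeGF≈chainGF M (suc s) 1+s<j)) (overlined D) ⟩
    chainGF k (suc M) (suc s) ∎
    where
    open ≈-Reasoning
    D = ⌊ k ∣? suc M ⌋
    s<j = ℕₚ.<-trans (n<1+n s) 1+s<j
    overlined : ∀ D → mon 1 (2 + s) ⊠ (if D then sizeGF M s else [])
                      ≈ (if D then mon 1 (2 + s) ⊠ chainGF k M s else [])
    overlined true  = TermRing.*-congˡ {mon 1 (2 + s)} (sizeGF≈chainGF M s s<j)
    overlined false = TermRing.zeroʳ (mon 1 (2 + s))

  gf-inBL : ∀ M s → s < j → gf (inBL k (suc M) (suc s)) (candidates (suc M) j) ≈ headedGF M (suc s , true)
  gf-inBL M s s<j = begin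
    gf (inBL k (suc M) (suc s)) (candidates (suc M) j)
      ≡⟨ gf-candidates-suc _ M j ⟩
    concatMap (λ p → map (partTerm p ∙_) (gf (λ l → inBL k (suc M) (suc s) (p ∷ l)) (candidates M j))) (partsUpTo j)
      ≡⟨ Listₚ.concatMap-cong (λ p → cong (map (partTerm p ∙_))
           (trans (gf-cong (candidates M j) (All.map (λ {l} → first-part p l) (candidates-length M j)))
                  (gf-const (firstIs p) (λ l → valid k (p ∷ l)) (candidates M j)))) (partsUpTo j) ⟩
    concatMap (λ p → guardedGF M (firstIs p) p) (partsUpTo j)
      ≈⟨ concatMap-partsUpTo-single (λ p → guardedGF M (firstIs p) p) j s s<j
           (λ t b t≢s → ≡⇒≈ (cong (λ c → guardedGF M (c ∧ b) (suc t , b)) (≡ᵇ-false t≢s))) ⟩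
    guardedGF M (firstIs (suc s , false)) (suc s , false) ++ guardedGF M (firstIs (suc s , true)) (suc s , true)
      ≡⟨ cong (λ c → guardedGF M (c ∧ false) (suc s , false) ++ guardedGF M (c ∧ true) (suc s , true))
              (≡ᵇ-true {s} refl) ⟩
    headedGF M (suc s , true) ∎
    where
    open ≈-Reasoning
    firstIs : Part → Bool
    firstIs p = (size p ≡ᵇ suc s) ∧ ov p
    first-part : ∀ p l → length l ≡ M → inBL k (suc M) (suc s) (p ∷ l) ≡ firstIs p ∧ valid k (p ∷ l)
    first-part p l refl = inBL-∷ k (suc s) p l

GL-chainGF : ∀ k M r → k ∣ suc M → GL k (2 + M) (2 + r) ≐ ⟦ mon 1 (2 + r) ⊠ chainGF k M r ⟧
GL-chainGF k M r k∣ a n = trans (gf-count (inBL k (2 + M) (2 + r)) (candidates (2 + M) (2 + r)) a n) (⟦≈⟧ (begin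
  gf (inBL k (2 + M) (2 + r)) (candidates (2 + M) (2 + r))
    ≈⟨ gf-inBL (suc M) (suc r) (n<1+n (suc r)) ⟩
  map (partTerm (2 + r , true) ∙_) (tailGF (suc M) (2 + r , true))
    ≈⟨ map∙-cong (partTerm (2 + r , true)) (tailGF-overlined M r (ℕₚ.<-trans (n<1+n r) (n<1+n (suc r)))) ⟩
  mon 1 (2 + r) ⊠ (if ⌊ k ∣? suc M ⌋ then sizeGF M r else [])
    ≡⟨ cong (λ c → mon 1 (2 + r) ⊠ (if c then sizeGF M r else [])) (⌊⌋-true (k ∣? suc M) k∣) ⟩
  mon 1 (2 + r) ⊠ sizeGF M r
    ≈⟨ TermRing.*-congˡ {mon 1 (2 + r)} (sizeGF≈chainGF M r (ℕₚ.<-trans (n<1+n r) (n<1+n (suc r)))) ⟩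
  mon 1 (2 + r) ⊠ chainGF k M r ∎) a n)
  where
  open ≈-Reasoning
  open Tails k (2 + r)

-- Closed form of the chain generating functions

[1+n]C2 : ∀ n → suc n C 2 ≡ n + n C 2
[1+n]C2 n = trans (sym (nCk+nC[k+1]≡[n+1]C[k+1] n 1)) (cong (_+ n C 2) (nC1≡n n))

module _ (k′ : ℕ) where

  private
    k : ℕ
    k = suc k′

  k*suc : ∀ t → k * suc t ≡ suc (k * t + k′)
  k*suc t = identity k′ t
    where
    identity : ∀ k′ t → suc k′ * suc t ≡ suc (suc k′ * t + k′)
    identity = solve-∀

  k∤k*t+1+i : ∀ t i → suc i < k → ¬ k ∣ suc (k * t + i)
  k∤k*t+1+i t i 1+i<k k∣1+k*t+i = <⇒≱ 1+i<k (∣⇒≤ (∣m+n∣m⇒∣n k∣k*t+1+i (m∣m*n t)))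
    where
    k∣k*t+1+i : k ∣ k * t + suc i
    k∣k*t+1+i = subst (k ∣_) (sym (ℕₚ.+-suc (k * t) i)) k∣1+k*t+i

  k∣k*suc : ∀ t → k ∣ suc (k * t + k′)
  k∣k*suc t = subst (k ∣_) (k*suc t) (m∣m*n (suc t))

  chainGF-shift : ∀ t i s → i < k → chainGF k (k * t + i) s ≈ q^ (suc s * i) ⊠ chainGF k (k * t) s
  chainGF-shift t zero s _ rewrite ℕₚ.+-identityʳ (k * t) | ℕₚ.*-zeroʳ s =
    ≡⇒≈ (sym (⊠-identityˡ (chainGF k (k * t) s)))
  chainGF-shift t (suc i) s 1+i<k rewrite ℕₚ.+-suc (k * t) i = begin
    chainGF k (suc (k * t + i)) s
      ≈⟨ chainGF-∤ k (k * t + i) s (k∤k*t+1+i t i 1+i<k) ⟩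
    q^ (suc s) ⊠ chainGF k (k * t + i) s
      ≈⟨ TermRing.*-congˡ {q^ (suc s)} (chainGF-shift t i s (ℕₚ.<-trans (n<1+n i) 1+i<k)) ⟩
    q^ (suc s) ⊠ (q^ (suc s * i) ⊠ chainGF k (k * t) s)
      ≡⟨ sym (⊠-assoc (q^ (suc s)) (q^ (suc s * i)) _) ⟩
    q^ (suc s + suc s * i) ⊠ chainGF k (k * t) s
      ≡⟨ cong (λ e → q^ e ⊠ chainGF k (k * t) s) (sym (ℕₚ.*-suc (suc s) i)) ⟩
    q^ (suc s * suc i) ⊠ chainGF k (k * t) s ∎
    where open ≈-Reasoning

  chainGF-step : ∀ t s → chainGF k (k * suc t) (suc s)
    ≈ q^ (k * (2 + s)) ⊠ chainGF k (k * t) (suc s) ++ mon 1 (suc (k * suc s)) ⊠ chainGF k (k * t) s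
  chainGF-step t s = begin
    chainGF k (k * suc t) (suc s)
      ≡⟨ cong (λ M → chainGF k M (suc s)) (k*suc t) ⟩
    chainGF k (suc (k * t + k′)) (suc s)
      ≡⟨ chainGF-∣ k (k * t + k′) s (k∣k*suc t) ⟩
    q^ (2 + s) ⊠ chainGF k (k * t + k′) (suc s) ++ mon 1 (2 + s) ⊠ chainGF k (k * t + k′) s
      ≈⟨ TermRing.+-cong (TermRing.*-congˡ {q^ (2 + s)} (chainGF-shift t k′ (suc s) (n<1+n k′)))
                         (TermRing.*-congˡ {mon 1 (2 + s)} (chainGF-shift t k′ s (n<1+n k′))) ⟩
    q^ (2 + s) ⊠ (q^ (suc (suc s) * k′) ⊠ A₁) ++ mon 1 (2 + s) ⊠ (q^ (suc s * k′) ⊠ A₀)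
      ≡⟨ cong₂ _++_ (sym (⊠-assoc (q^ (2 + s)) (q^ (suc (suc s) * k′)) A₁))
                    (sym (⊠-assoc (mon 1 (2 + s)) (q^ (suc s * k′)) A₀)) ⟩
    q^ (2 + s + suc (suc s) * k′) ⊠ A₁ ++ mon 1 (2 + s + suc s * k′) ⊠ A₀
      ≡⟨ cong₂ (λ e e′ → q^ e ⊠ A₁ ++ mon 1 e′ ⊠ A₀) (plain k′ s) (overlined k′ s) ⟩
    q^ (k * (2 + s)) ⊠ A₁ ++ mon 1 (suc (k * suc s)) ⊠ A₀ ∎
    where
    open ≈-Reasoning
    A₁ = chainGF k (k * t) (suc s)
    A₀ = chainGF k (k * t) s
    plain : ∀ k′ s → 2 + s + suc (suc s) * k′ ≡ suc k′ * (2 + s)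
    plain = solve-∀
    overlined : ∀ k′ s → 2 + s + suc s * k′ ≡ suc (suc k′ * suc s)
    overlined = solve-∀

  chainGF-vanish : ∀ t s → t < s → chainGF k (k * t) s ≈ []
  chainGF-vanish zero    (suc s) _         rewrite ℕₚ.*-zeroʳ k = TermRing.refl
  chainGF-vanish (suc t) (suc s) (s≤s t<s) = begin
    chainGF k (k * suc t) (suc s)
      ≈⟨ chainGF-step t s ⟩
    q^ (k * (2 + s)) ⊠ chainGF k (k * t) (suc s) ++ mon 1 (suc (k * suc s)) ⊠ chainGF k (k * t) s
      ≈⟨ TermRing.+-cong (TermRing.*-congˡ {q^ (k * (2 + s))} (chainGF-vanish t (suc s) (ℕₚ.m<n⇒m<1+n t<s)))
                         (TermRing.*-congˡ {mon 1 (suc (k * suc s))} (chainGF-vanish t s t<s)) ⟩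
    q^ (k * (2 + s)) ⊠ [] ++ mon 1 (suc (k * suc s)) ⊠ []
      ≈⟨ TermRing.+-cong (TermRing.zeroʳ (q^ (k * (2 + s)))) (TermRing.zeroʳ (mon 1 (suc (k * suc s)))) ⟩
    [] ∎
    where open ≈-Reasoning

  chainExp : ℕ → ℕ → ℕ
  chainExp r u = k * (suc r C 2) + suc r + k * u

  chainExp-overlined : ∀ r u → suc (k * suc r) + chainExp r u ≡ chainExp (suc r) u
  chainExp-overlined r u =
    trans (identity k′ (suc r C 2) r u) (cong (λ c → k * c + suc (suc r) + k * u) (sym ([1+n]C2 (suc r))))
    where
    identity : ∀ k′ c r u → suc (suc k′ * suc r) + (suc k′ * c + suc r + suc k′ * u)
                          ≡ suc k′ * (suc r + c) + suc (suc r) + suc k′ * u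
    identity = solve-∀

  chainExp-plain : ∀ r u → k * (2 + r) + chainExp (suc r) u ≡ k * suc r + chainExp (suc r) (suc u)
  chainExp-plain r u = identity k′ ((2 + r) C 2) r u
    where
    identity : ∀ k′ c r u → suc k′ * (2 + r) + (suc k′ * c + (2 + r) + suc k′ * u)
                          ≡ suc k′ * suc r + (suc k′ * c + (2 + r) + suc k′ * suc u)
    identity = solve-∀

  pascal : ∀ r u →
    q^ (k * (2 + r)) ⊠ pair (suc r) (chainExp (suc r) u) ⊠ pochFactor k (suc u)
    ++ mon 1 (suc (k * suc r)) ⊠ pair r (chainExp r (suc u)) ⊠ pochFactor k (suc r)
    ≈ pair (suc r) (chainExp (suc r) (suc u)) ⊠ pochFactor k (2 + r + u)
  pascal r u = begin
    q^ (k * (2 + r)) ⊠ pair (suc r) (chainExp (suc r) u) ⊠ pochFactor k (suc u)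
    ++ mon 1 (suc (k * suc r)) ⊠ pair r (chainExp r (suc u)) ⊠ pochFactor k (suc r)
      ≡⟨ cong₂ (λ e e′ → pair (suc r) e ⊠ pochFactor k (suc u) ++ pair (suc r) e′ ⊠ pochFactor k (suc r))
               (chainExp-plain r u) (chainExp-overlined r (suc u)) ⟩
    q^ (k * suc r) ⊠ W ⊠ pochFactor k (suc u) ++ W ⊠ pochFactor k (suc r)
      ≈⟨ solve 3 (λ Y X W → Y :* W :* (con (+ 1) :- X) :+ W :* (con (+ 1) :- Y) := W :* (con (+ 1) :- Y :* X))
               TermRing.refl (q^ (k * suc r)) (q^ (k * suc u)) W ⟩
    W ⊠ (1ₗ ++ ⊟ q^ (k * suc r + k * suc u))
      ≡⟨ cong (λ e → W ⊠ (1ₗ ++ ⊟ q^ e)) (identity k′ r u) ⟩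
    W ⊠ pochFactor k (2 + r + u) ∎
    where
    open ≈-Reasoning
    W = pair (suc r) (chainExp (suc r) (suc u))
    identity : ∀ k′ r u → suc k′ * suc r + suc k′ * suc u ≡ suc k′ * (2 + r + u)
    identity = solve-∀

  -- chainGF k (k (r + u)) r = (z^r + z^{r+1}) q^{chainExp r u} [r+u, r]_{q^k}, with the
  -- denominators of the q-binomial coefficient cleared.
  ChainClosed : ℕ → ℕ → ℕ → Set
  ChainClosed r u t = chainGF k (k * t) r ⊠ pochₗ k r ⊠ pochₗ k u ≈ pair r (chainExp r u) ⊠ pochₗ k t

  chainClosed-zero : ∀ u → ChainClosed 0 u u
  chainClosed-zero u = begin
    chainGF k (k * u) 0 ⊠ 1ₗ ⊠ pochₗ k u
      ≈⟨ TermRing.*-congʳ (TermRing.*-identityʳ (chainGF k (k * u) 0)) ⟩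
    chainGF k (k * u) 0 ⊠ pochₗ k u
      ≡⟨ cong (_⊠ pochₗ k u) (trans (chainGF-zero k (k * u)) (cong (pair 0) (identity k′ u))) ⟩
    pair 0 (chainExp 0 u) ⊠ pochₗ k u ∎
    where
    open ≈-Reasoning
    identity : ∀ k′ u → suc (suc k′ * u) ≡ suc k′ * 0 + 1 + suc k′ * u
    identity = solve-∀

  chainClosed-top : ∀ r → ChainClosed r 0 r → ChainClosed (suc r) 0 (suc r)
  chainClosed-top r ih = begin
    chainGF k (k * suc r) (suc r) ⊠ (P r ⊠ L) ⊠ 1ₗ
      ≈⟨ TermRing.*-congʳ (TermRing.*-congʳ top-overlined) ⟩
    Z ⊠ A ⊠ (P r ⊠ L) ⊠ 1ₗ
      ≈⟨ solve 4 (λ Z A P L → Z :* A :* (P :* L) :* con (+ 1) := Z :* L :* (A :* P :* con (+ 1)))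
               TermRing.refl Z A (P r) L ⟩
    Z ⊠ L ⊠ (A ⊠ P r ⊠ 1ₗ)
      ≈⟨ TermRing.*-congˡ {Z ⊠ L} ih ⟩
    Z ⊠ L ⊠ (pair r (chainExp r 0) ⊠ P r)
      ≈⟨ solve 4 (λ Z L W P → Z :* L :* (W :* P) := Z :* W :* (P :* L))
               TermRing.refl Z L (pair r (chainExp r 0)) (P r) ⟩
    pair (suc r) (suc (k * suc r) + chainExp r 0) ⊠ (P r ⊠ L)
      ≡⟨ cong (λ e → pair (suc r) e ⊠ P (suc r)) (chainExp-overlined r 0) ⟩
    pair (suc r) (chainExp (suc r) 0) ⊠ P (suc r) ∎
    where
    open ≈-Reasoning
    P = pochₗ k
    L = pochFactor k (suc r)
    Z = mon 1 (suc (k * suc r))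
    A = chainGF k (k * r) r
    top-overlined : chainGF k (k * suc r) (suc r) ≈ Z ⊠ A
    top-overlined = TermRing.trans (chainGF-step r r) (TermRing.+-cong
      (TermRing.trans (TermRing.*-congˡ {q^ (k * (2 + r))} (chainGF-vanish r (suc r) (n<1+n r)))
                      (TermRing.zeroʳ (q^ (k * (2 + r)))))
      (TermRing.refl {Z ⊠ A}))

  chainClosed-step : ∀ r u → ChainClosed (suc r) u (suc (r + u)) → ChainClosed r (suc u) (suc (r + u)) →
                     ChainClosed (suc r) (suc u) (2 + r + u)
  chainClosed-step r u ih₁ ih₀ = begin
    chainGF k (k * suc t) (suc r) ⊠ (P r ⊠ Lr) ⊠ (P u ⊠ Lu)
      ≈⟨ TermRing.*-congʳ (TermRing.*-congʳ (chainGF-step t r)) ⟩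
    (Q ⊠ A₁ ++ Z ⊠ A₀) ⊠ (P r ⊠ Lr) ⊠ (P u ⊠ Lu)
      ≈⟨ solve 8 (λ Q A₁ Z A₀ Pr Lr Pu Lu →
                   (Q :* A₁ :+ Z :* A₀) :* (Pr :* Lr) :* (Pu :* Lu)
                   := Q :* Lu :* (A₁ :* (Pr :* Lr) :* Pu) :+ Z :* Lr :* (A₀ :* Pr :* (Pu :* Lu)))
               TermRing.refl Q A₁ Z A₀ (P r) Lr (P u) Lu ⟩
    Q ⊠ Lu ⊠ (A₁ ⊠ P (suc r) ⊠ P u) ++ Z ⊠ Lr ⊠ (A₀ ⊠ P r ⊠ P (suc u))
      ≈⟨ TermRing.+-cong (TermRing.*-congˡ {Q ⊠ Lu} ih₁) (TermRing.*-congˡ {Z ⊠ Lr} ih₀) ⟩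
    Q ⊠ Lu ⊠ (W₁ ⊠ P t) ++ Z ⊠ Lr ⊠ (W₀ ⊠ P t)
      ≈⟨ solve 7 (λ Q Lu W₁ Pt Z Lr W₀ →
                   Q :* Lu :* (W₁ :* Pt) :+ Z :* Lr :* (W₀ :* Pt) := (Q :* W₁ :* Lu :+ Z :* W₀ :* Lr) :* Pt)
               TermRing.refl Q Lu W₁ (P t) Z Lr W₀ ⟩
    (Q ⊠ W₁ ⊠ Lu ++ Z ⊠ W₀ ⊠ Lr) ⊠ P t
      ≈⟨ TermRing.*-congʳ {P t} (pascal r u) ⟩
    W ⊠ pochFactor k (suc t) ⊠ P t
      ≈⟨ solve 3 (λ W L Pt → W :* L :* Pt := W :* (Pt :* L)) TermRing.refl W (pochFactor k (suc t)) (P t) ⟩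
    W ⊠ P (suc t) ∎
    where
    open ≈-Reasoning
    t = suc (r + u)
    P = pochₗ k
    Lr = pochFactor k (suc r)
    Lu = pochFactor k (suc u)
    Q = q^ (k * (2 + r))
    Z = mon 1 (suc (k * suc r))
    A₁ = chainGF k (k * t) (suc r)
    A₀ = chainGF k (k * t) r
    W₁ = pair (suc r) (chainExp (suc r) u)
    W₀ = pair r (chainExp r (suc u))
    W = pair (suc r) (chainExp (suc r) (suc u))

  chainGF-closed : ∀ r u → ChainClosed r u (r + u)
  chainGF-closed zero    u       = chainClosed-zero u
  chainGF-closed (suc r) zero    =
    subst (ChainClosed (suc r) 0 ∘ suc) (sym (ℕₚ.+-identityʳ r))
      (chainClosed-top r (subst (ChainClosed r 0) (ℕₚ.+-identityʳ r) (chainGF-closed r 0)))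
  chainGF-closed (suc r) (suc u) =
    subst (ChainClosed (suc r) (suc u) ∘ suc) (sym (ℕₚ.+-suc r u))
      (chainClosed-step r u (chainGF-closed (suc r) u)
        (subst (ChainClosed r (suc u)) (ℕₚ.+-suc r u) (chainGF-closed r (suc u))))

  GLterms-cleared : ∀ r u →
    mon 1 (2 + r) ⊠ chainGF k (k * (r + u) + k′) r ⊠ pochₗ k r ⊠ pochₗ k u
    ≈ pair (suc r) (k * ((2 + r) C 2) + (2 + r) + k * u) ⊠ pochₗ k (r + u)
  GLterms-cleared r u = begin
    Z ⊠ chainGF k (k * t + k′) r ⊠ pochₗ k r ⊠ pochₗ k u
      ≈⟨ TermRing.*-congʳ (TermRing.*-congʳ (TermRing.*-congˡ {Z} (chainGF-shift t k′ r (n<1+n k′)))) ⟩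
    Z ⊠ (q^ (suc r * k′) ⊠ chainGF k (k * t) r) ⊠ pochₗ k r ⊠ pochₗ k u
      ≈⟨ solve 5 (λ Z Q A P₁ P₂ → Z :* (Q :* A) :* P₁ :* P₂ := Z :* Q :* (A :* P₁ :* P₂))
               TermRing.refl Z (q^ (suc r * k′)) (chainGF k (k * t) r) (pochₗ k r) (pochₗ k u) ⟩
    Z ⊠ q^ (suc r * k′) ⊠ (chainGF k (k * t) r ⊠ pochₗ k r ⊠ pochₗ k u)
      ≈⟨ TermRing.*-congˡ {Z ⊠ q^ (suc r * k′)} (chainGF-closed r u) ⟩
    Z ⊠ q^ (suc r * k′) ⊠ (pair r (chainExp r u) ⊠ pochₗ k t)
      ≈⟨ TermRing.sym (TermRing.*-assoc (Z ⊠ q^ (suc r * k′)) (pair r (chainExp r u)) (pochₗ k t)) ⟩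
    pair (suc r) (2 + r + suc r * k′ + chainExp r u) ⊠ pochₗ k t
      ≡⟨ cong (λ e → pair (suc r) e ⊠ pochₗ k t)
              (trans (identity k′ (suc r C 2) r u) (cong (λ c → k * c + (2 + r) + k * u) (sym ([1+n]C2 (suc r))))) ⟩
    pair (suc r) (k * ((2 + r) C 2) + (2 + r) + k * u) ⊠ pochₗ k t ∎
    where
    open ≈-Reasoning
    t = r + u
    Z = mon 1 (2 + r)
    identity : ∀ k′ c r u → 2 + r + suc r * k′ + (suc k′ * c + suc r + suc k′ * u)
                          ≡ suc k′ * (suc r + c) + (2 + r) + suc k′ * u
    identity = solve-∀

  GL-cleared : ∀ r u →
    (GL k (k * suc (r + u) + 1) (2 + r) ⊛ poch k r) ⊛ poch k u
    ≐ (mono (suc r) (k * ((2 + r) C 2) + (2 + r) + k * u) ⊕ mono (2 + r) (k * ((2 + r) C 2) + (2 + r) + k * u))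
      ⊛ poch k (r + u)
  GL-cleared r u a n = begin
    ((GL k (k * suc t + 1) (2 + r) ⊛ poch k r) ⊛ poch k u) a n
      ≡⟨ ⊛-cong (⊛-cong GL≐ (λ a n → sym (⟦pochₗ⟧ k r a n))) (λ a n → sym (⟦pochₗ⟧ k u a n)) a n ⟩
    ((⟦ Z ⊠ chainGF k M r ⟧ ⊛ ⟦ pochₗ k r ⟧) ⊛ ⟦ pochₗ k u ⟧) a n
      ≡⟨ sym (⟦⊠⟧-≐ (Z ⊠ chainGF k M r ⊠ pochₗ k r) (pochₗ k u)
                    (⟦⊠⟧ (Z ⊠ chainGF k M r) (pochₗ k r)) (λ _ _ → refl) a n) ⟩
    ⟦ Z ⊠ chainGF k M r ⊠ pochₗ k r ⊠ pochₗ k u ⟧ a n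
      ≡⟨ ⟦≈⟧ (GLterms-cleared r u) a n ⟩
    ⟦ pair (suc r) E ⊠ pochₗ k t ⟧ a n
      ≡⟨ ⟦⊠⟧-≐ (pair (suc r) E) (pochₗ k t) (⟦pair⟧ (suc r) E) (⟦pochₗ⟧ k t) a n ⟩
    ((mono (suc r) E ⊕ mono (2 + r) E) ⊛ poch k t) a n ∎
    where
    open ≡-Reasoning
    t = r + u
    M = k * t + k′
    Z = mon 1 (2 + r)
    E = k * ((2 + r) C 2) + (2 + r) + k * u
    GL≐ : GL k (k * suc t + 1) (2 + r) ≐ ⟦ Z ⊠ chainGF k M r ⟧
    GL≐ a n = trans (cong (λ N → GL k N (2 + r) a n) (trans (ℕₚ.+-comm (k * suc t) 1) (cong suc (k*suc t))))
                    (GL-chainGF k M r (k∣k*suc t) a n)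

lemma3p6 : (k m j : ℕ) → 1 ≤ k → 2 ≤ j → j ≤ m → (a n : ℕ) →
    ((GL k (k * (m ∸ 1) + 1) j ⊛ poch k (j ∸ 2)) ⊛ poch k ((m ∸ 2) ∸ (j ∸ 2))) a n
    ≡ (((mono (j ∸ 1) (k * (j C 2) + j + k * (m ∸ j)) ⊕ mono j (k * (j C 2) + j + k * (m ∸ j))))
    ⊛ poch k (m ∸ 2)) a n
lemma3p6 (suc k′) (suc (suc m′)) (suc (suc r)) (s≤s z≤n) (s≤s (s≤s z≤n)) (s≤s (s≤s r≤m′)) a n
  with ℕₚ.m≤n⇒∃[o]m+o≡n r≤m′
... | u , refl rewrite ℕₚ.m+n∸m≡n r u = GL-cleared k′ r u a n
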